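{- For every $n$ and every set $A$ of vertices of the $n$-cycle $C_n$, if $A$ is maximally even then $A$ is a maximizer of $W$ on $C_n$. However, there exist $n$ and a maximizer of $W$ on $C_n$ that is not maximally even.
   Context: $C_n$ has vertices $0,\ldots,n-1$ arranged clockwise, $u$ adjacent to $u\pm1 \bmod n$; $d$ is the geodesic distance; $W(X)=\sum_{\{u,v\}\subseteq X,\,u\neq v}d(u,v)$, and $A$ is a maximizer of $W$ if $W(A)=\max\{W(B): B\subseteq V(C_n), |B|=|A|\}$. $d^*(u,v)$ is the least non-negative integer congruent to $v-u$ mod $n$. For $A=\{a_0<\cdots<a_{m-1}\}$, $\mathrm{span}_A(a_i,a_j)$ is the least positive integer congruent to $j-i$ mod $m$, and $\sigma^*_k(A)=[\,d^*(u,v): u,v\in A, u\neq v, \mathrm{span}_A(u,v)=k\,]$ (ordered pairs). $A$ is maximally even if for each $1\leq k\leq m-1$ the set of distinct values in $\sigma^*_k(A)$ is a single integer or two consecutive integers. -}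

module Defs where

open import Data.Nat using (ℕ; zero; suc; _+_; _∸_; _≤_; _<_; _≤ᵇ_; _<ᵇ_; _⊓_)
open import Data.Bool using (if_then_else_)
open import Data.Fin using (Fin; toℕ)
open import Data.Fin.Subset using (Subset; ∣_∣)
open import Data.Fin.Subset.Properties using (_∈?_)
open import Data.List using (List; []; _∷_; length; filter; allFin; lookup; map)
open import Data.Nat.ListAction using (sum)
open import Data.Product using (∃-syntax)
open import Data.Sum using (_⊎_)
open import Relation.Binary.PropositionalEquality using (_≡_; _≢_)

-- d*(u,v): least non-negative integer congruent to v - u mod n
dstar : ∀ {n} → Fin n → Fin n → ℕ
dstar {n} u v = if toℕ u ≤ᵇ toℕ v then toℕ v ∸ toℕ u else (n + toℕ v) ∸ toℕ u

dist : ∀ {n} → Fin n → Fin n → ℕ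
dist u v = dstar u v ⊓ dstar v u

elems : ∀ {n} → Subset n → List (Fin n)
elems {n} A = filter (_∈? A) (allFin n)

pairSum : ∀ {n} → List (Fin n) → ℕ
pairSum []       = 0
pairSum (x ∷ xs) = sum (map (dist x) xs) + pairSum xs

W : ∀ {n} → Subset n → ℕ
W A = pairSum (elems A)

Maximizer : ∀ {n} → Subset n → Set
Maximizer {n} A = ∀ (B : Subset n) → ∣ B ∣ ≡ ∣ A ∣ → W B ≤ W A

-- span between indices i, j of an m-element set:
-- least positive integer congruent to j - i mod m
spanIdx : ∀ {m} → Fin m → Fin m → ℕ
spanIdx {m} i j = if toℕ i <ᵇ toℕ j then toℕ j ∸ toℕ i else (m + toℕ j) ∸ toℕ i

-- maximally even: for each 1 ≤ k ≤ m-1, all values of σ*_k(A) lie in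
-- {c, c+1} for some c (i.e. the set of distinct values is a single integer
-- or two consecutive integers; σ*_k is nonempty for such k)
MaximallyEven : ∀ {n} → Subset n → Set
MaximallyEven A =
  ∀ (k : ℕ) → 1 ≤ k → suc k ≤ length (elems A) →
    ∃[ c ] ∀ (i j : Fin (length (elems A))) → i ≢ j → spanIdx i j ≡ k →
      (dstar (lookup (elems A) i) (lookup (elems A) j) ≡ c
        ⊎ dstar (lookup (elems A) i) (lookup (elems A) j) ≡ suc c)

{-# OPTIONS --safe #-}
module Submission where

-- Let a be the increasing enumeration of A, with m elements, and let i ⊕ k be addition mod m.
-- Then 2 W(A) = Σₖ Σᵢ d(aᵢ, a_{i⊕k}), and d(aᵢ, a_{i⊕k}) = min(x, n ∸ x) for x = d*(aᵢ, a_{i⊕k}).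
-- For a fixed offset k these x sum to k n whatever A is (the sum telescopes up to one n per
-- wrap-around), so by concavity of x ↦ min(x, n ∸ x) the inner sum is largest when the x take at
-- most two consecutive values, which is maximal evenness.

open import Defs
open import Data.Bool using (true; false; if_then_else_)
open import Data.Fin as Fin using (Fin; toℕ)
open import Data.Fin.Patterns using (0F; 1F; 2F)
open import Data.Fin.Permutation using (Permutation′; permutation)
open import Data.Fin.Properties using (toℕ-injective; toℕ<n; toℕ-fromℕ<)
open import Data.Fin.Subset using (Subset; ∣_∣)
open import Data.Fin.Subset.Properties using (_∈?_; anySubset?)
open import Data.List using (List; []; _∷_; length; lookup; map; filter; tabulate)
open import Data.List.Membership.Propositional.Properties using (∈-lookup)
import Data.List.Relation.Unary.All as All
open import Data.List.Relation.Unary.AllPairs using (AllPairs; _∷_)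
import Data.List.Relation.Unary.AllPairs.Properties as AllPairs
open import Data.Nat
  using (ℕ; zero; suc; _+_; _*_; _∸_; _≤_; _<_; _≤ᵇ_; _<ᵇ_; _⊓_; _%_; z≤n; s≤s; s≤s⁻¹; _<?_; _≤?_; _≟_; NonZero)
open import Data.Nat.DivMod
  using (_mod_; %-distribˡ-+; m%n%n≡m%n; m%n<n; %-remove-+ʳ; m<n⇒m%n≡m; n%n≡0; m≤n⇒[n∸m]%m≡n%m)
open import Data.Nat.Divisibility using (_∣_; m%n≡0⇒n∣m)
import Data.Nat.ListAction as List
open import Data.Nat.Properties
open import Data.Nat.Solver using (module +-*-Solver)
open import Data.Product using (_×_; _,_; ∃-syntax)
open import Data.Sum using (_⊎_; inj₁; inj₂)
open import Data.Vec using ([]; _∷_)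
open import Function using (_∘_; id)
open import Relation.Binary.Core using (_Preserves_⟶_)
open import Relation.Binary.Definitions using (tri<; tri≈; tri>)
open import Relation.Binary.PropositionalEquality
open import Relation.Nullary using (¬_; Dec; yes; no; does; contradiction; ¬?)
open import Relation.Nullary.Decidable using (_→-dec_; decidable-stable; from-yes)
open import Relation.Nullary.Reflects using (ofʸ; ofⁿ)

open import Algebra.Properties.CommutativeMonoid.Sum +-0-commutativeMonoid
  using (sum; sum-syntax; ∑-comm; ∑-distrib-+; ∑-permute; sum-cong-≗)
open import Algebra.Properties.CommutativeSemigroup +-commutativeSemigroup using (interchange)

∑-mono-≤ : ∀ {M} {f g : Fin M → ℕ} → (∀ i → f i ≤ g i) → sum f ≤ sum g
∑-mono-≤ {zero}  f≤g = z≤n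
∑-mono-≤ {suc M} f≤g = +-mono-≤ (f≤g Fin.zero) (∑-mono-≤ (f≤g ∘ Fin.suc))

[m%d+n]%d≡[m+n]%d : ∀ m n d .{{_ : NonZero d}} → (m % d + n) % d ≡ (m + n) % d
[m%d+n]%d≡[m+n]%d m n d = begin
  (m % d + n) % d          ≡⟨ %-distribˡ-+ (m % d) n d ⟩
  (m % d % d + n % d) % d  ≡⟨ cong (λ x → (x + n % d) % d) (m%n%n≡m%n m d) ⟩
  (m % d + n % d) % d      ≡⟨ %-distribˡ-+ m n d ⟨
  (m + n) % d              ∎
  where open ≡-Reasoning

toℕ-mod : ∀ n d .{{_ : NonZero d}} → toℕ (n mod d) ≡ n % d
toℕ-mod n d = toℕ-fromℕ< (m%n<n n d)

module _ {m : ℕ} where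

  infixl 6 _⊕_

  _⊕_ : Fin (suc m) → Fin (suc m) → Fin (suc m)
  i ⊕ k = (toℕ i + toℕ k) mod suc m

  ⊖_ : Fin (suc m) → Fin (suc m)
  ⊖ k = (suc m ∸ toℕ k) mod suc m

  toℕ-⊕ : ∀ i k → toℕ (i ⊕ k) ≡ (toℕ i + toℕ k) % suc m
  toℕ-⊕ i k = toℕ-mod (toℕ i + toℕ k) (suc m)

  ⊕-comm : ∀ i k → i ⊕ k ≡ k ⊕ i
  ⊕-comm i k = cong (_mod suc m) (+-comm (toℕ i) (toℕ k))

  ⊕-identityʳ : ∀ i → i ⊕ Fin.zero ≡ i
  ⊕-identityʳ i = toℕ-injective (begin
    toℕ (i ⊕ Fin.zero)  ≡⟨ toℕ-⊕ i Fin.zero ⟩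
    (toℕ i + 0) % suc m ≡⟨ cong (_% suc m) (+-identityʳ (toℕ i)) ⟩
    toℕ i % suc m       ≡⟨ m<n⇒m%n≡m (toℕ<n i) ⟩
    toℕ i               ∎)
    where open ≡-Reasoning

  ⊕-cancelʳ : ∀ i {k k′} → suc m ∣ toℕ k + toℕ k′ → i ⊕ k ⊕ k′ ≡ i
  ⊕-cancelʳ i {k} {k′} m∣k+k′ = toℕ-injective (begin
    toℕ (i ⊕ k ⊕ k′)                           ≡⟨ toℕ-⊕ (i ⊕ k) k′ ⟩
    (toℕ (i ⊕ k) + toℕ k′) % suc m             ≡⟨ cong (λ x → (x + toℕ k′) % suc m) (toℕ-⊕ i k) ⟩
    ((toℕ i + toℕ k) % suc m + toℕ k′) % suc m ≡⟨ [m%d+n]%d≡[m+n]%d (toℕ i + toℕ k) (toℕ k′) (suc m) ⟩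
    (toℕ i + toℕ k + toℕ k′) % suc m           ≡⟨ cong (_% suc m) (+-assoc (toℕ i) (toℕ k) (toℕ k′)) ⟩
    (toℕ i + (toℕ k + toℕ k′)) % suc m         ≡⟨ %-remove-+ʳ (toℕ i) m∣k+k′ ⟩
    toℕ i % suc m                              ≡⟨ m<n⇒m%n≡m (toℕ<n i) ⟩
    toℕ i                                      ∎)
    where open ≡-Reasoning

  ∣⊖k+k : ∀ k → suc m ∣ toℕ (⊖ k) + toℕ k
  ∣⊖k+k k = m%n≡0⇒n∣m _ (suc m) (begin
    (toℕ (⊖ k) + toℕ k) % suc m               ≡⟨ cong (λ x → (x + toℕ k) % suc m) (toℕ-mod (suc m ∸ toℕ k) (suc m)) ⟩
    ((suc m ∸ toℕ k) % suc m + toℕ k) % suc m ≡⟨ [m%d+n]%d≡[m+n]%d (suc m ∸ toℕ k) (toℕ k) (suc m) ⟩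
    (suc m ∸ toℕ k + toℕ k) % suc m           ≡⟨ cong (_% suc m) (m∸n+n≡m (<⇒≤ (toℕ<n k))) ⟩
    suc m % suc m                             ≡⟨ n%n≡0 (suc m) ⟩
    0                                         ∎)
    where open ≡-Reasoning

  shift : Fin (suc m) → Permutation′ (suc m)
  shift k = permutation (_⊕ k) (_⊕ ⊖ k)
    (λ i → ⊕-cancelʳ i (∣⊖k+k k))
    (λ i → ⊕-cancelʳ i (subst (suc m ∣_) (+-comm (toℕ (⊖ k)) (toℕ k)) (∣⊖k+k k)))

  ∑-⊕ : ∀ (f : Fin (suc m) → ℕ) k → ∑[ i < suc m ] f (i ⊕ k) ≡ sum f
  ∑-⊕ f k = sym (∑-permute f (shift k))

spanIdx-< : ∀ {M} {i j : Fin M} → toℕ i < toℕ j → spanIdx i j ≡ toℕ j ∸ toℕ i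
spanIdx-< {i = i} {j} i<j with toℕ i <ᵇ toℕ j | <ᵇ-reflects-< (toℕ i) (toℕ j)
... | true  | _        = refl
... | false | ofⁿ i≮j = contradiction i<j i≮j

spanIdx-≥ : ∀ {M} {i j : Fin M} → toℕ j ≤ toℕ i → spanIdx i j ≡ M + toℕ j ∸ toℕ i
spanIdx-≥ {i = i} {j} j≤i with toℕ i <ᵇ toℕ j | <ᵇ-reflects-< (toℕ i) (toℕ j)
... | true  | ofʸ i<j = contradiction j≤i (<⇒≱ i<j)
... | false | _       = refl

spanIdx-⊕ : ∀ {m} (i k : Fin (suc m)) → 1 ≤ toℕ k → spanIdx i (i ⊕ k) ≡ toℕ k
spanIdx-⊕ {m} i k 1≤k with toℕ i + toℕ k <? suc m
... | yes i+k<M = begin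
  spanIdx i (i ⊕ k)     ≡⟨ spanIdx-< i<i⊕k ⟩
  toℕ (i ⊕ k) ∸ toℕ i   ≡⟨ cong (_∸ toℕ i) i⊕k≡i+k ⟩
  toℕ i + toℕ k ∸ toℕ i ≡⟨ m+n∸m≡n (toℕ i) (toℕ k) ⟩
  toℕ k                 ∎
  where
  open ≡-Reasoning
  i⊕k≡i+k : toℕ (i ⊕ k) ≡ toℕ i + toℕ k
  i⊕k≡i+k = trans (toℕ-⊕ i k) (m<n⇒m%n≡m i+k<M)
  i<i⊕k : toℕ i < toℕ (i ⊕ k)
  i<i⊕k = subst (toℕ i <_) (sym i⊕k≡i+k) (m<m+n (toℕ i) 1≤k)
... | no i+k≮M = begin
  spanIdx i (i ⊕ k)                       ≡⟨ spanIdx-≥ i⊕k≤i ⟩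
  suc m + toℕ (i ⊕ k) ∸ toℕ i             ≡⟨ cong (λ x → suc m + x ∸ toℕ i) i⊕k≡i+k∸M ⟩
  suc m + (toℕ i + toℕ k ∸ suc m) ∸ toℕ i ≡⟨ cong (_∸ toℕ i) (m+[n∸m]≡n M≤i+k) ⟩
  toℕ i + toℕ k ∸ toℕ i                   ≡⟨ m+n∸m≡n (toℕ i) (toℕ k) ⟩
  toℕ k                                   ∎
  where
  open ≡-Reasoning
  M≤i+k : suc m ≤ toℕ i + toℕ k
  M≤i+k = ≮⇒≥ i+k≮M
  i⊕k≡i+k∸M : toℕ (i ⊕ k) ≡ toℕ i + toℕ k ∸ suc m
  i⊕k≡i+k∸M = begin
    toℕ (i ⊕ k)                     ≡⟨ toℕ-⊕ i k ⟩
    (toℕ i + toℕ k) % suc m         ≡⟨ m≤n⇒[n∸m]%m≡n%m M≤i+k ⟨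
    (toℕ i + toℕ k ∸ suc m) % suc m ≡⟨ m<n⇒m%n≡m (m<n+o⇒m∸n<o _ (suc m) (+-mono-< (toℕ<n i) (toℕ<n k))) ⟩
    toℕ i + toℕ k ∸ suc m           ∎
  i⊕k≤i : toℕ (i ⊕ k) ≤ toℕ i
  i⊕k≤i = subst (_≤ toℕ i) (sym i⊕k≡i+k∸M) (≤-trans
    (∸-monoˡ-≤ (suc m) (+-monoʳ-≤ (toℕ i) (<⇒≤ (toℕ<n k))))
    (≤-reflexive (m+n∸n≡m (toℕ i) (suc m))))

⊕-≢ : ∀ {m} (i k : Fin (suc m)) → 1 ≤ toℕ k → i ≢ i ⊕ k
⊕-≢ {m} i k 1≤k i≡i⊕k = <⇒≢ (toℕ<n k) (begin
  toℕ k                 ≡⟨ spanIdx-⊕ i k 1≤k ⟨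
  spanIdx i (i ⊕ k)     ≡⟨ cong (spanIdx i) i≡i⊕k ⟨
  spanIdx i i           ≡⟨ spanIdx-≥ {i = i} {i} ≤-refl ⟩
  suc m + toℕ i ∸ toℕ i ≡⟨ m+n∸n≡m (suc m) (toℕ i) ⟩
  suc m                 ∎)
  where open ≡-Reasoning

carry : ℕ → ℕ → ℕ → ℕ
carry n x y = if x ≤ᵇ y then 0 else n

carry-+-carry : ∀ n {x y} → x ≢ y → carry n x y + carry n y x ≡ n
carry-+-carry n {x} {y} x≢y with x ≤ᵇ y | ≤ᵇ-reflects-≤ x y | y ≤ᵇ x | ≤ᵇ-reflects-≤ y x
... | true  | ofʸ x≤y | true  | ofʸ y≤x = contradiction (≤-antisym x≤y y≤x) x≢y
... | true  | _       | false | _       = refl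
... | false | _       | true  | _       = +-identityʳ n
... | false | ofⁿ x≰y | false | ofⁿ y≰x = contradiction (≰⇒≥ x≰y) y≰x

dstar-+ : ∀ {n} (u v : Fin n) → dstar u v + toℕ u ≡ toℕ v + carry n (toℕ u) (toℕ v)
dstar-+ {n} u v with toℕ u ≤ᵇ toℕ v | ≤ᵇ-reflects-≤ (toℕ u) (toℕ v)
... | true  | ofʸ u≤v = trans (m∸n+n≡m u≤v) (sym (+-identityʳ (toℕ v)))
... | false | _       = trans (m∸n+n≡m (≤-trans (<⇒≤ (toℕ<n u)) (m≤m+n n (toℕ v)))) (+-comm n (toℕ v))

dstar≤n : ∀ {n} (u v : Fin n) → dstar u v ≤ n
dstar≤n {n} u v with toℕ u ≤ᵇ toℕ v | ≤ᵇ-reflects-≤ (toℕ u) (toℕ v)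
... | true  | _       = ≤-trans (m∸n≤m (toℕ v) (toℕ u)) (<⇒≤ (toℕ<n v))
... | false | ofⁿ u≰v = ≤-trans (∸-monoˡ-≤ (toℕ u) (+-monoʳ-≤ n (≰⇒≥ u≰v))) (≤-reflexive (m+n∸n≡m n (toℕ u)))

dstar-self : ∀ {n} (u : Fin n) → dstar u u ≡ 0
dstar-self u with toℕ u ≤ᵇ toℕ u | ≤ᵇ-reflects-≤ (toℕ u) (toℕ u)
... | true  | _       = n∸n≡0 (toℕ u)
... | false | ofⁿ u≰u = contradiction ≤-refl u≰u

dstar-+-dstar : ∀ {n} {u v : Fin n} → u ≢ v → dstar u v + dstar v u ≡ n
dstar-+-dstar {n} {u} {v} u≢v = +-cancelʳ-≡ (toℕ u + toℕ v) _ _ (begin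
  dstar u v + dstar v u + (toℕ u + toℕ v)          ≡⟨ interchange (dstar u v) (dstar v u) (toℕ u) (toℕ v) ⟩
  (dstar u v + toℕ u) + (dstar v u + toℕ v)        ≡⟨ cong₂ _+_ (dstar-+ u v) (dstar-+ v u) ⟩
  (toℕ v + carry n (toℕ u) (toℕ v)) + (toℕ u + carry n (toℕ v) (toℕ u))
    ≡⟨ interchange (toℕ v) _ (toℕ u) _ ⟩
  (toℕ v + toℕ u) + (carry n (toℕ u) (toℕ v) + carry n (toℕ v) (toℕ u))
    ≡⟨ cong₂ _+_ (+-comm (toℕ v) (toℕ u)) (carry-+-carry n (u≢v ∘ toℕ-injective)) ⟩
  (toℕ u + toℕ v) + n                              ≡⟨ +-comm _ n ⟩
  n + (toℕ u + toℕ v)                              ∎)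
  where open ≡-Reasoning

cycleNorm : ℕ → ℕ → ℕ
cycleNorm n x = x ⊓ (n ∸ x)

dist≡cycleNorm-dstar : ∀ {n} (u v : Fin n) → dist u v ≡ cycleNorm n (dstar u v)
dist≡cycleNorm-dstar {n} u v with u Fin.≟ v
... | yes refl rewrite dstar-self u = refl
... | no u≢v = cong (dstar u v ⊓_) (sym (begin
  n ∸ dstar u v                     ≡⟨ cong (_∸ dstar u v) (dstar-+-dstar u≢v) ⟨
  dstar u v + dstar v u ∸ dstar u v ≡⟨ m+n∸m≡n (dstar u v) (dstar v u) ⟩
  dstar v u                         ∎))
  where open ≡-Reasoning

cycleNorm≡id : ∀ {n x} → x + x ≤ n → cycleNorm n x ≡ x
cycleNorm≡id {x = x} x+x≤n = m≤n⇒m⊓n≡m (m+n≤o⇒m≤o∸n x x+x≤n)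

cycleNorm≡complement : ∀ {n x} → n ≤ x + x → cycleNorm n x ≡ n ∸ x
cycleNorm≡complement {n} {x} n≤x+x = m≥n⇒m⊓n≡n (m≤n+o⇒m∸n≤o n x n≤x+x)

cycleNorm-+-≤ : ∀ {n x} → x ≤ n → cycleNorm n x + x ≤ n
cycleNorm-+-≤ {n} {x} x≤n = ≤-trans (+-monoˡ-≤ x (m⊓n≤n x (n ∸ x))) (≤-reflexive (m∸n+n≡m x≤n))

cycleNorm-+-cycleNorm-≤ : ∀ {n x} → x ≤ n → cycleNorm n x + cycleNorm n x ≤ n
cycleNorm-+-cycleNorm-≤ {n} {x} x≤n =
  ≤-trans (+-mono-≤ (m⊓n≤m x (n ∸ x)) (m⊓n≤n x (n ∸ x))) (≤-reflexive (m+[n∸m]≡n x≤n))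

Balanced : ℕ → ℕ → Set
Balanced c y = y ≡ c ⊎ y ≡ suc c

balanced-≥ : ∀ {c y} → Balanced c y → c ≤ y
balanced-≥ (inj₁ refl) = ≤-refl
balanced-≥ (inj₂ refl) = n≤1+n _

balanced-≤ : ∀ {c y} → Balanced c y → y ≤ suc c
balanced-≤ (inj₁ refl) = n≤1+n _
balanced-≤ (inj₂ refl) = ≤-refl

m+m≤1+2n⇒m≤n : ∀ {m n} → m + m ≤ suc (n + n) → m ≤ n
m+m≤1+2n⇒m≤n {m} {n} m+m≤1+2n = ≮⇒≥ λ n<m → 1+n≰n (begin
  suc (suc (n + n)) ≡⟨ cong suc (+-suc n n) ⟨
  suc n + suc n     ≤⟨ +-mono-≤ n<m n<m ⟩
  m + m             ≤⟨ m+m≤1+2n ⟩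
  suc (n + n)       ∎)
  where open ≤-Reasoning

module _ {M} (n c : ℕ) {x y : Fin M → ℕ} (y-balanced : ∀ i → Balanced c (y i)) (Σx≡Σy : sum x ≡ sum y) where

  ∑-cycleNorm-≤-balanced-n≤2c : n ≤ c + c → (∀ i → x i ≤ n) → (∀ i → y i ≤ n) →
                                ∑[ i < M ] cycleNorm n (x i) ≤ ∑[ i < M ] cycleNorm n (y i)
  ∑-cycleNorm-≤-balanced-n≤2c n≤2c x≤n y≤n = +-cancelʳ-≤ (sum x) _ _ (begin
    ∑[ i < M ] cycleNorm n (x i) + sum x  ≡⟨ ∑-distrib-+ (cycleNorm n ∘ x) x ⟨
    ∑[ i < M ] (cycleNorm n (x i) + x i)  ≤⟨ ∑-mono-≤ (λ i → cycleNorm-+-≤ (x≤n i)) ⟩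
    ∑[ i < M ] n                          ≡⟨ sum-cong-≗ cycleNorm-y+y≡n ⟨
    ∑[ i < M ] (cycleNorm n (y i) + y i)  ≡⟨ ∑-distrib-+ (cycleNorm n ∘ y) y ⟩
    ∑[ i < M ] cycleNorm n (y i) + sum y  ≡⟨ cong (_ +_) Σx≡Σy ⟨
    ∑[ i < M ] cycleNorm n (y i) + sum x  ∎)
    where
    open ≤-Reasoning
    n≤y+y : ∀ i → n ≤ y i + y i
    n≤y+y i = ≤-trans n≤2c (+-mono-≤ (balanced-≥ (y-balanced i)) (balanced-≥ (y-balanced i)))
    cycleNorm-y+y≡n : ∀ i → cycleNorm n (y i) + y i ≡ n
    cycleNorm-y+y≡n i = trans (cong (_+ y i) (cycleNorm≡complement (n≤y+y i))) (m∸n+n≡m (y≤n i))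

  ∑-cycleNorm-≤-balanced-n≡1+2c : n ≡ suc (c + c) → (∀ i → x i ≤ n) →
                                  ∑[ i < M ] cycleNorm n (x i) ≤ ∑[ i < M ] cycleNorm n (y i)
  ∑-cycleNorm-≤-balanced-n≡1+2c refl x≤n = ∑-mono-≤ λ i → begin
    cycleNorm n (x i) ≤⟨ m+m≤1+2n⇒m≤n (cycleNorm-+-cycleNorm-≤ (x≤n i)) ⟩
    c                 ≡⟨ cycleNorm-balanced (y-balanced i) ⟨
    cycleNorm n (y i) ∎
    where
    open ≤-Reasoning
    cycleNorm-balanced : ∀ {z} → Balanced c z → cycleNorm n z ≡ c
    cycleNorm-balanced (inj₁ refl) = cycleNorm≡id (n≤1+n (c + c))
    cycleNorm-balanced (inj₂ refl) = trans (cycleNorm≡complement (s≤s (+-monoʳ-≤ c (n≤1+n c)))) (m+n∸m≡n c c)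

  ∑-cycleNorm-≤-balanced-2+2c≤n : suc (suc (c + c)) ≤ n →
                                  ∑[ i < M ] cycleNorm n (x i) ≤ ∑[ i < M ] cycleNorm n (y i)
  ∑-cycleNorm-≤-balanced-2+2c≤n 2+2c≤n = begin
    ∑[ i < M ] cycleNorm n (x i) ≤⟨ ∑-mono-≤ (λ i → m⊓n≤m (x i) (n ∸ x i)) ⟩
    sum x                        ≡⟨ Σx≡Σy ⟩
    sum y                        ≡⟨ sum-cong-≗ (λ i → cycleNorm≡id (y+y≤n i)) ⟨
    ∑[ i < M ] cycleNorm n (y i) ∎
    where
    open ≤-Reasoning
    y+y≤n : ∀ i → y i + y i ≤ n
    y+y≤n i = begin
      y i + y i         ≤⟨ +-mono-≤ (balanced-≤ (y-balanced i)) (balanced-≤ (y-balanced i)) ⟩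
      suc c + suc c     ≡⟨ cong suc (+-suc c c) ⟩
      suc (suc (c + c)) ≤⟨ 2+2c≤n ⟩
      n                 ∎

-- In each case a line through the values of cycleNorm n at c and suc c lies above cycleNorm n on [0, n]:
-- x ↦ n ∸ x, the constant c, or x ↦ x.  Summed against that line, x and y differ only through sum x ≡ sum y.
∑-cycleNorm-≤-balanced : ∀ {M} n c {x y : Fin M → ℕ} → (∀ i → x i ≤ n) → (∀ i → y i ≤ n) →
                         (∀ i → Balanced c (y i)) → sum x ≡ sum y →
                         ∑[ i < M ] cycleNorm n (x i) ≤ ∑[ i < M ] cycleNorm n (y i)
∑-cycleNorm-≤-balanced n c x≤n y≤n y-balanced Σx≡Σy with <-cmp n (suc (c + c))
... | tri< n<1+2c _ _ = ∑-cycleNorm-≤-balanced-n≤2c n c y-balanced Σx≡Σy (s≤s⁻¹ n<1+2c) x≤n y≤n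
... | tri≈ _ n≡1+2c _ = ∑-cycleNorm-≤-balanced-n≡1+2c n c y-balanced Σx≡Σy n≡1+2c x≤n
... | tri> _ _ 1+2c<n = ∑-cycleNorm-≤-balanced-2+2c≤n n c y-balanced Σx≡Σy 1+2c<n

monotone-carry : ∀ {M n} {a : Fin M → Fin n} → a Preserves Fin._<_ ⟶ Fin._<_ →
                 ∀ i j → carry n (toℕ (a i)) (toℕ (a j)) ≡ carry n (toℕ i) (toℕ j)
monotone-carry {a = a} a-inc i j
  with toℕ (a i) ≤ᵇ toℕ (a j) | ≤ᵇ-reflects-≤ (toℕ (a i)) (toℕ (a j))
     | toℕ i ≤ᵇ toℕ j | ≤ᵇ-reflects-≤ (toℕ i) (toℕ j)
... | true  | _          | true  | _       = refl
... | false | _          | false | _       = refl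
... | true  | ofʸ ai≤aj  | false | ofⁿ i≰j = contradiction ai≤aj (<⇒≱ (a-inc (≰⇒> i≰j)))
... | false | ofⁿ ai≰aj | true  | ofʸ i≤j with m≤n⇒m<n∨m≡n i≤j
...   | inj₁ i<j = contradiction (<⇒≤ (a-inc i<j)) ai≰aj
...   | inj₂ i≡j = contradiction (≤-reflexive (cong (toℕ ∘ a) (toℕ-injective i≡j))) ai≰aj

∑-dstar-⊕ : ∀ {m n} {a : Fin (suc m) → Fin n} → a Preserves Fin._<_ ⟶ Fin._<_ → ∀ k →
            ∑[ i < suc m ] dstar (a i) (a (i ⊕ k)) ≡ ∑[ i < suc m ] carry n (toℕ i) (toℕ (i ⊕ k))
∑-dstar-⊕ {m} {n} {a} a-inc k = +-cancelʳ-≡ (sum (toℕ ∘ a)) _ _ (begin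
  ∑[ i < suc m ] dstar (a i) (a (i ⊕ k)) + sum (toℕ ∘ a)
    ≡⟨ ∑-distrib-+ (λ i → dstar (a i) (a (i ⊕ k))) (toℕ ∘ a) ⟨
  ∑[ i < suc m ] (dstar (a i) (a (i ⊕ k)) + toℕ (a i))
    ≡⟨ sum-cong-≗ (λ i → dstar-+ (a i) (a (i ⊕ k))) ⟩
  ∑[ i < suc m ] (toℕ (a (i ⊕ k)) + carry n (toℕ (a i)) (toℕ (a (i ⊕ k))))
    ≡⟨ ∑-distrib-+ (λ i → toℕ (a (i ⊕ k))) (λ i → carry n (toℕ (a i)) (toℕ (a (i ⊕ k)))) ⟩
  ∑[ i < suc m ] toℕ (a (i ⊕ k)) + ∑[ i < suc m ] carry n (toℕ (a i)) (toℕ (a (i ⊕ k)))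
    ≡⟨ cong₂ _+_ (∑-⊕ (toℕ ∘ a) k) (sum-cong-≗ (λ i → monotone-carry a-inc i (i ⊕ k))) ⟩
  sum (toℕ ∘ a) + ∑[ i < suc m ] carry n (toℕ i) (toℕ (i ⊕ k))
    ≡⟨ +-comm (sum (toℕ ∘ a)) _ ⟩
  ∑[ i < suc m ] carry n (toℕ i) (toℕ (i ⊕ k)) + sum (toℕ ∘ a) ∎)
  where open ≡-Reasoning

-- MaximallyEven A unfolds to MaximallyEvenSeq (lookup (elems A)).
MaximallyEvenSeq : ∀ {M n} → (Fin M → Fin n) → Set
MaximallyEvenSeq {M} a =
  ∀ k → 1 ≤ k → suc k ≤ M →
    ∃[ c ] ∀ (i j : Fin M) → i ≢ j → spanIdx i j ≡ k → Balanced c (dstar (a i) (a j))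

maximallyEven⇒balanced-⊕ : ∀ {m n} {a : Fin (suc m) → Fin n} → MaximallyEvenSeq a →
                   ∀ k → ∃[ c ] ∀ i → Balanced c (dstar (a i) (a (i ⊕ k)))
maximallyEven⇒balanced-⊕ {a = a} a-even Fin.zero =
  0 , λ i → inj₁ (trans (cong (dstar (a i) ∘ a) (⊕-identityʳ i)) (dstar-self (a i)))
maximallyEven⇒balanced-⊕ a-even k@(Fin.suc _) with a-even (toℕ k) (s≤s z≤n) (toℕ<n k)
... | c , balanced = c , λ i → balanced i (i ⊕ k) (⊕-≢ i k (s≤s z≤n)) (spanIdx-⊕ i k (s≤s z≤n))

∑∑dist : ∀ {M n} → (Fin M → Fin n) → ℕ
∑∑dist {M} a = ∑[ i < M ] ∑[ j < M ] dist (a i) (a j)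

∑∑dist-by-offset : ∀ {m n} (a : Fin (suc m) → Fin n) →
                   ∑∑dist a ≡ ∑[ k < suc m ] ∑[ i < suc m ] dist (a i) (a (i ⊕ k))
∑∑dist-by-offset {m} a = trans (sum-cong-≗ reindex) (∑-comm (λ i k → dist (a i) (a (i ⊕ k))))
  where
  reindex : ∀ i → ∑[ j < suc m ] dist (a i) (a j) ≡ ∑[ k < suc m ] dist (a i) (a (i ⊕ k))
  reindex i = trans (sym (∑-⊕ (dist (a i) ∘ a) i)) (sum-cong-≗ (λ k → cong (dist (a i) ∘ a) (⊕-comm k i)))

∑-dist-⊕-≤ : ∀ {m n} {a b : Fin (suc m) → Fin n} →
              a Preserves Fin._<_ ⟶ Fin._<_ → b Preserves Fin._<_ ⟶ Fin._<_ → MaximallyEvenSeq a →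
              ∀ k → ∑[ i < suc m ] dist (b i) (b (i ⊕ k)) ≤ ∑[ i < suc m ] dist (a i) (a (i ⊕ k))
∑-dist-⊕-≤ {m} {n} {a} {b} a-inc b-inc a-even k with maximallyEven⇒balanced-⊕ {a = a} a-even k
... | c , a-balanced = begin
  ∑[ i < suc m ] dist (b i) (b (i ⊕ k))
    ≡⟨ sum-cong-≗ (λ i → dist≡cycleNorm-dstar (b i) (b (i ⊕ k))) ⟩
  ∑[ i < suc m ] cycleNorm n (dstar (b i) (b (i ⊕ k)))
    ≤⟨ ∑-cycleNorm-≤-balanced n c (λ i → dstar≤n (b i) (b (i ⊕ k))) (λ i → dstar≤n (a i) (a (i ⊕ k))) a-balanced
         (trans (∑-dstar-⊕ {a = b} b-inc k) (sym (∑-dstar-⊕ {a = a} a-inc k))) ⟩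
  ∑[ i < suc m ] cycleNorm n (dstar (a i) (a (i ⊕ k)))
    ≡⟨ sum-cong-≗ (λ i → dist≡cycleNorm-dstar (a i) (a (i ⊕ k))) ⟨
  ∑[ i < suc m ] dist (a i) (a (i ⊕ k)) ∎
  where open ≤-Reasoning

∑∑dist-maximal : ∀ {M M′ n} {a : Fin M → Fin n} {b : Fin M′ → Fin n} → M′ ≡ M →
                 a Preserves Fin._<_ ⟶ Fin._<_ → b Preserves Fin._<_ ⟶ Fin._<_ → MaximallyEvenSeq a →
                 ∑∑dist b ≤ ∑∑dist a
∑∑dist-maximal {zero}  refl a-inc b-inc a-even = z≤n
∑∑dist-maximal {suc m} {a = a} {b} refl a-inc b-inc a-even =
  subst₂ _≤_ (sym (∑∑dist-by-offset b)) (sym (∑∑dist-by-offset a))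
    (∑-mono-≤ (∑-dist-⊕-≤ {a = a} {b} a-inc b-inc a-even))

sum-map≡∑-lookup : ∀ {A : Set} (f : A → ℕ) (xs : List A) →
                   List.sum (map f xs) ≡ ∑[ i < length xs ] f (lookup xs i)
sum-map≡∑-lookup f []       = refl
sum-map≡∑-lookup f (x ∷ xs) = cong (f x +_) (sum-map≡∑-lookup f xs)

dist-self : ∀ {n} (u : Fin n) → dist u u ≡ 0
dist-self u = cong₂ _⊓_ (dstar-self u) (dstar-self u)

dist-comm : ∀ {n} (u v : Fin n) → dist u v ≡ dist v u
dist-comm u v = ⊓-comm (dstar u v) (dstar v u)

∑∑dist-lookup : ∀ {n} (xs : List (Fin n)) → ∑∑dist (lookup xs) ≡ 2 * pairSum xs
∑∑dist-lookup []       = refl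
∑∑dist-lookup (x ∷ xs) = begin
  dist x x + ∑[ j < m ] dist x (l j) + ∑[ i < m ] (dist (l i) x + ∑[ j < m ] dist (l i) (l j))
    ≡⟨ cong₂ _+_ (cong (_+ Σx) (dist-self x)) (∑-distrib-+ (λ i → dist (l i) x) _) ⟩
  Σx + (∑[ i < m ] dist (l i) x + ∑∑dist l)
    ≡⟨ cong₂ (λ s t → Σx + (s + t)) (sum-cong-≗ (λ i → dist-comm (l i) x)) (∑∑dist-lookup xs) ⟩
  Σx + (Σx + 2 * pairSum xs)
    ≡⟨ solve 2 (λ s p → s :+ (s :+ con 2 :* p) := con 2 :* (s :+ p)) refl Σx (pairSum xs) ⟩
  2 * (Σx + pairSum xs)
    ≡⟨ cong (λ s → 2 * (s + pairSum xs)) (sum-map≡∑-lookup (dist x) xs) ⟨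
  2 * pairSum (x ∷ xs) ∎
  where
  open ≡-Reasoning
  open +-*-Solver
  m = length xs
  l = lookup xs
  Σx = ∑[ j < m ] dist x (l j)

AllPairs-lookup : ∀ {A : Set} {R : A → A → Set} {xs : List A} → AllPairs R xs →
                  ∀ {i j} → i Fin.< j → R (lookup xs i) (lookup xs j)
AllPairs-lookup (Rx ∷ _)  {Fin.zero}  {Fin.suc j} _         = All.lookup Rx (∈-lookup j)
AllPairs-lookup (_ ∷ Rxs) {Fin.suc i} {Fin.suc j} (s≤s i<j) = AllPairs-lookup Rxs i<j

elems-increasing : ∀ {n} (A : Subset n) → lookup (elems A) Preserves Fin._<_ ⟶ Fin._<_
elems-increasing A = AllPairs-lookup (AllPairs.filter⁺ (_∈? A) (AllPairs.tabulate⁺-< {R = Fin._<_} {f = id} id))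

length-filter-∈?-∷ : ∀ {n k} x (A : Subset n) (g : Fin k → Fin n) →
                     length (filter (_∈? (x ∷ A)) (tabulate (Fin.suc ∘ g))) ≡ length (filter (_∈? A) (tabulate g))
length-filter-∈?-∷ {k = zero}  x A g = refl
length-filter-∈?-∷ {k = suc k} x A g with does (g Fin.zero ∈? A)
... | true  = cong suc (length-filter-∈?-∷ x A (g ∘ Fin.suc))
... | false = length-filter-∈?-∷ x A (g ∘ Fin.suc)

length-elems : ∀ {n} (A : Subset n) → length (elems A) ≡ ∣ A ∣
length-elems []          = refl
length-elems (true ∷ A)  = cong suc (trans (length-filter-∈?-∷ true A id) (length-elems A))
length-elems (false ∷ A) = trans (length-filter-∈?-∷ false A id) (length-elems A)

maximallyEven⇒maximizer : ∀ n (A : Subset n) → MaximallyEven A → Maximizer A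
maximallyEven⇒maximizer _ A A-even B ∣B∣≡∣A∣ = *-cancelˡ-≤ 2 (begin
  2 * W B                    ≡⟨ ∑∑dist-lookup (elems B) ⟨
  ∑∑dist (lookup (elems B))  ≤⟨ ∑∑dist-maximal same-length (elems-increasing A) (elems-increasing B) A-even ⟩
  ∑∑dist (lookup (elems A))  ≡⟨ ∑∑dist-lookup (elems A) ⟩
  2 * W A                    ∎)
  where
  open ≤-Reasoning
  same-length : length (elems B) ≡ length (elems A)
  same-length = trans (length-elems B) (trans ∣B∣≡∣A∣ (sym (length-elems A)))

maximizer? : ∀ {n} (A : Subset n) → Dec (Maximizer A)
maximizer? A with anySubset? (λ B → ¬? (∣ B ∣ ≟ ∣ A ∣ →-dec W B ≤? W A))
... | yes (B , B-beats-A) = no λ A-max → B-beats-A (A-max B)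
... | no  none-beats-A    = yes λ B →
  decidable-stable (∣ B ∣ ≟ ∣ A ∣ →-dec W B ≤? W A) (λ B-beats-A → none-beats-A (B , B-beats-A))

-- W {0,1,3} = 6 = W {0,2,4} is the maximum for three vertices of C₆, but the gaps 1, 2, 3 of {0,1,3} are not
-- within one of each other.
A₀₁₃ : Subset 6
A₀₁₃ = true ∷ true ∷ false ∷ true ∷ false ∷ false ∷ []

A₀₁₃-not-maximallyEven : ¬ MaximallyEven A₀₁₃
A₀₁₃-not-maximallyEven A-even with A-even 1 (s≤s z≤n) (s≤s (s≤s z≤n))
... | c , balanced with balanced 0F 1F (λ ()) refl | balanced 2F 0F (λ ()) refl
... | inj₁ refl | inj₁ ()
... | inj₁ refl | inj₂ ()
... | inj₂ refl | inj₁ ()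
... | inj₂ refl | inj₂ ()

corollary4p6 : (∀ (n : ℕ) (A : Subset n) → MaximallyEven A → Maximizer A)
    × (∃[ n ] ∃[ A ] (Maximizer {n} A × ¬ MaximallyEven {n} A))
corollary4p6 = maximallyEven⇒maximizer , 6 , A₀₁₃ , from-yes (maximizer? A₀₁₃) , A₀₁₃-not-maximallyEven
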